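{- Let $n\in\mathbb{N}$ and let $S=\{\pi_1,\dots,\pi_m\}\subseteq S_n$ be symmetric. For $1\le i\le n-1$ let $A_i=\{1\le j\le m: i\notin\operatorname{Des}(\pi_j)\}$. Then there exist $k,\ell_1,\ell_2\ge 0$ such that $|A_i|=k$ for all $1\le i\le n-1$, $|A_i\cap A_j|=\ell_1$ whenever $|i-j|=1$, and $|A_i\cap A_j|=\ell_2$ whenever $|i-j|\ge 2$.
   Context: $S_n$ is the symmetric group on $[n]$ in one-line notation. The descent set of $\pi\in S_n$ is $\operatorname{Des}(\pi)=\{i\in[n-1]:\pi_i>\pi_{i+1}\}$. For $T\subseteq[n-1]$, $F_T=\sum x_{i_1}\cdots x_{i_n}$ over $i_1\le\dots\le i_n$ with $i_j<i_{j+1}$ for $j\in T$. A set $S\subseteq S_n$ is symmetric if $\sum_{\pi\in S}F_{\operatorname{Des}(\pi)}$ is a symmetric function. -}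

module Defs where

open import Data.Nat.Base using (ℕ; zero; suc; _≤ᵇ_; _<ᵇ_; _≡ᵇ_; _∸_)
open import Data.Bool.Base using (Bool; true; false; _∧_; _∨_; not; if_then_else_)
open import Data.List.Base using (List; []; _∷_; applyUpTo; concatMap; map; length)
open import Data.Nat.ListAction using (sum)
open import Data.List.Relation.Binary.Permutation.Propositional using (_↭_)
open import Relation.Binary.PropositionalEquality using (_≡_)

upto1 : ℕ → List ℕ
upto1 n = applyUpTo suc n

-- 1-based lookup with a default (only used in range)
at : {A : Set} → A → List A → ℕ → A
at d []       _             = d
at d (x ∷ xs) zero          = d
at d (x ∷ xs) (suc zero)    = x
at d (x ∷ xs) (suc (suc i)) = at d xs (suc i)

filterᵇ : {A : Set} → (A → Bool) → List A → List A
filterᵇ p []       = []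
filterᵇ p (x ∷ xs) = if p x then x ∷ filterᵇ p xs else filterᵇ p xs

countᵇ : {A : Set} → (A → Bool) → List A → ℕ
countᵇ p xs = length (filterᵇ p xs)

allᵇ : {A : Set} → (A → Bool) → List A → Bool
allᵇ p []       = true
allᵇ p (x ∷ xs) = p x ∧ allᵇ p xs

anyᵇ : {A : Set} → (A → Bool) → List A → Bool
anyᵇ p []       = false
anyᵇ p (x ∷ xs) = p x ∨ anyᵇ p xs

_∩_ : List ℕ → List ℕ → List ℕ
xs ∩ ys = filterᵇ (λ x → anyᵇ (λ y → x ≡ᵇ y) ys) xs

-- Permutations of [n] in one-line notation: a word π₁ … πₙ which is a
-- rearrangement of 1 … n.

IsPerm : ℕ → List ℕ → Set
IsPerm n w = w ↭ upto1 n

desᵇ : ℕ → List ℕ → ℕ → Bool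
desᵇ n π i = (1 ≤ᵇ i) ∧ (i <ᵇ n) ∧ (at 0 π (suc i) <ᵇ at 0 π i)

-- Fundamental quasisymmetric function F_T of degree n, T ⊆ [n-1] given by
-- its (Boolean) membership predicate.  A monomial x₁^{α₁} ⋯ x_k^{α_k}
-- (all other exponents 0) is represented by its exponent list α.
-- Its coefficient in F_T is the number of sequences i₁ ≤ ⋯ ≤ iₙ
-- (with i_j < i_{j+1} for j ∈ T) such that x_{i₁}⋯x_{iₙ} = x^α; such
-- indices necessarily lie in [k], k = length α.

words : ℕ → ℕ → List (List ℕ)
words k zero    = [] ∷ []
words k (suc n) = concatMap (λ c → map (c ∷_) (words k n)) (upto1 k)

admissibleᵇ : ℕ → (ℕ → Bool) → List ℕ → Bool
admissibleᵇ n T s =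
  allᵇ (λ j → if T j then at 0 s j <ᵇ at 0 s (suc j)
                    else at 0 s j ≤ᵇ at 0 s (suc j))
       (upto1 (n ∸ 1))

hasContentᵇ : List ℕ → List ℕ → Bool
hasContentᵇ α s = allᵇ (λ c → countᵇ (λ x → x ≡ᵇ c) s ≡ᵇ at 0 α c) (upto1 (length α))

coeffF : ℕ → (ℕ → Bool) → List ℕ → ℕ
coeffF n T α =
  countᵇ (λ s → admissibleᵇ n T s ∧ hasContentᵇ α s) (words (length α) n)

coeffSum : ℕ → List (List ℕ) → List ℕ → ℕ
coeffSum n S α = sum (map (λ π → coeffF n (desᵇ n π) α) S)

-- S is symmetric: Σ_{π∈S} F_{Des π} is invariant under permutations of the
-- variables, i.e. the coefficient of x^α depends only on the multiset of
-- exponents (padding α with zeros does not change a coefficient).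
Symmetric : ℕ → List (List ℕ) → Set
Symmetric n S = ∀ (α β : List ℕ) → α ↭ β → coeffSum n S α ≡ coeffSum n S β

A : ℕ → List (List ℕ) → ℕ → List ℕ
A n S i = filterᵇ (λ j → not (desᵇ n (at [] S j) i)) (upto1 (length S))

-- The coefficient of x^α in F_D (α a weak composition of n) is 1 if the weakly increasing
-- word 1^α₁ 2^α₂ ⋯ ascends strictly at every position of D, and 0 otherwise.  If α consists
-- of ones and a single 2, chosen so that the word repeats a letter exactly at positions
-- i, i+1, this coefficient is [i ∉ D]; a single 3 (repeats at i, i+1, i+2) gives
-- [i, i+1 ∉ D]; two 2's (repeats at i, i+1 and at j, j+1, where j ≥ i + 2) give [i, j ∉ D].
-- Summing over S, |A_i|, |A_i ∩ A_(i+1)| and |A_i ∩ A_j| are coefficients of Σ_π F_(Des π)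
-- at monomials with exponent multisets {2,1,…}, {3,1,…}, {2,2,1,…} independent of i and j,
-- and symmetry says that such coefficients only depend on the multiset.
module Submission where

open import Defs
open import Data.Bool.Base using (Bool; true; false; T; _∧_; not; if_then_else_)
open import Data.Bool.Properties using (T-∧; T-∨; T-≡; ∧-comm; ∧-identityʳ; ∧-zeroʳ)
open import Data.Empty using (⊥-elim)
open import Data.List.Base using (List; []; _∷_; _++_; map; replicate; applyUpTo; upTo; concatMap; length)
open import Data.List.Properties using (≡-dec; ++-assoc; length-++; length-map; length-replicate; map-∘; map-cong; map-cong-local; map-applyUpTo)
open import Data.List.Relation.Unary.All as All using (All; []; _∷_)
open import Data.List.Relation.Unary.All.Properties using (++⁺; concat⁺; map⁺; replicate⁺; applyUpTo⁺₁; applyUpTo⁺₂)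
open import Data.List.Relation.Unary.Linked as Linked using (Linked; []; [-]; _∷_)
open import Data.List.Relation.Unary.Linked.Properties as Linkedₚ using (Linked⇒All)
open import Data.List.Relation.Unary.Unique.Propositional using (Unique)
open import Data.List.Relation.Binary.Permutation.Propositional using (_↭_; prep; ↭-trans; ↭-reflexive)
open import Data.List.Relation.Binary.Permutation.Propositional.Properties using (shift)
open import Data.Nat.Base using (ℕ; zero; suc; _+_; _*_; _≤_; _∸_; _≡ᵇ_; _<ᵇ_; _≤ᵇ_; ∣_-_∣; z≤n; s≤s; s≤s⁻¹)
open import Data.Nat.ListAction using (sum)
open import Data.Nat.ListAction.Properties using (sum-↭)
open import Data.Nat.Properties
  using (_≟_; ≡ᵇ⇒≡; ≡⇒≡ᵇ; <ᵇ⇒<; ≤ᵇ⇒≤; <⇒≤; ≤-trans; suc-injective;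
         m≤n⇒∃[o]m+o≡n; *-zeroʳ; +-comm; +-assoc; +-identityʳ; *-identityˡ; *-identityʳ; *-suc)
open import Data.Product using (_×_; _,_; proj₁; proj₂; map₂; ∃-syntax)
open import Data.Sum as Sum using (_⊎_; inj₁; inj₂)
open import Data.Unit.Base using (tt)
open import Function using (_∘_; id; Equivalence)
open import Relation.Nullary.Decidable.Core using (does; yes; no)
open import Relation.Binary.Definitions using (DecidableEquality)
open import Relation.Binary.PropositionalEquality using (_≡_; refl; sym; trans; cong; cong₂; subst; module ≡-Reasoning)

open ≡-Reasoning
open Equivalence using (to; from)

indicator : Bool → ℕ
indicator b = if b then 1 else 0

module _ {X : Set} where

  count-∷ : ∀ (p : X → Bool) x xs → countᵇ p (x ∷ xs) ≡ indicator (p x) + countᵇ p xs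
  count-∷ p x xs with p x
  ... | true  = refl
  ... | false = refl

  count-as-sum : ∀ (p : X → Bool) xs → countᵇ p xs ≡ sum (map (indicator ∘ p) xs)
  count-as-sum p []       = refl
  count-as-sum p (x ∷ xs) = trans (count-∷ p x xs) (cong (indicator (p x) +_) (count-as-sum p xs))

  count-cong-local : ∀ {p q : X → Bool} {xs} → All (λ x → p x ≡ q x) xs → countᵇ p xs ≡ countᵇ q xs
  count-cong-local {p} {q} {xs} p≡q = begin
    countᵇ p xs                   ≡⟨ count-as-sum p xs ⟩
    sum (map (indicator ∘ p) xs)  ≡⟨ cong sum (map-cong-local (All.map (cong indicator) p≡q)) ⟩
    sum (map (indicator ∘ q) xs)  ≡⟨ count-as-sum q xs ⟨
    countᵇ q xs                   ∎

  count-cong : ∀ {p q : X → Bool} → (∀ x → p x ≡ q x) → ∀ xs → countᵇ p xs ≡ countᵇ q xs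
  count-cong p≡q xs = count-cong-local (All.universal p≡q xs)

  count-false : ∀ xs → countᵇ (λ (_ : X) → false) xs ≡ 0
  count-false []       = refl
  count-false (_ ∷ xs) = count-false xs

  count-const-∧ : ∀ b (q : X → Bool) xs → countᵇ (λ x → b ∧ q x) xs ≡ indicator b * countᵇ q xs
  count-const-∧ true  q xs = sym (*-identityˡ _)
  count-const-∧ false q xs = count-false xs

  count-++ : ∀ (p : X → Bool) xs ys → countᵇ p (xs ++ ys) ≡ countᵇ p xs + countᵇ p ys
  count-++ p []       ys = refl
  count-++ p (x ∷ xs) ys = begin
    countᵇ p (x ∷ xs ++ ys)                          ≡⟨ count-∷ p x (xs ++ ys) ⟩
    indicator (p x) + countᵇ p (xs ++ ys)            ≡⟨ cong (indicator (p x) +_) (count-++ p xs ys) ⟩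
    indicator (p x) + (countᵇ p xs + countᵇ p ys)    ≡⟨ +-assoc (indicator (p x)) _ _ ⟨
    indicator (p x) + countᵇ p xs + countᵇ p ys      ≡⟨ cong (_+ countᵇ p ys) (count-∷ p x xs) ⟨
    countᵇ p (x ∷ xs) + countᵇ p ys                  ∎

  count-filter : ∀ (p q : X → Bool) xs → countᵇ q (filterᵇ p xs) ≡ countᵇ (λ x → p x ∧ q x) xs
  count-filter p q []       = refl
  count-filter p q (x ∷ xs) with p x
  ... | false = count-filter p q xs
  ... | true with q x
  ...   | true  = cong suc (count-filter p q xs)
  ...   | false = count-filter p q xs

  allᵇ⁺ : ∀ {p : X → Bool} {xs} → All (T ∘ p) xs → T (allᵇ p xs)
  allᵇ⁺ []         = tt
  allᵇ⁺ (px ∷ pxs) = from T-∧ (px , allᵇ⁺ pxs)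

  allᵇ⁻ : ∀ {p : X → Bool} xs → T (allᵇ p xs) → All (T ∘ p) xs
  allᵇ⁻ []       _   = []
  allᵇ⁻ (x ∷ xs) all = proj₁ (to T-∧ all) ∷ allᵇ⁻ xs (proj₂ (to T-∧ all))

module _ {X Y : Set} where

  count-map : ∀ (p : Y → Bool) (f : X → Y) xs → countᵇ p (map f xs) ≡ countᵇ (p ∘ f) xs
  count-map p f xs = begin
    countᵇ p (map f xs)                  ≡⟨ count-as-sum p (map f xs) ⟩
    sum (map (indicator ∘ p) (map f xs)) ≡⟨ cong sum (map-∘ xs) ⟨
    sum (map (indicator ∘ p ∘ f) xs)     ≡⟨ count-as-sum (p ∘ f) xs ⟨
    countᵇ (p ∘ f) xs                    ∎

  count-concatMap : ∀ (p : Y → Bool) (f : X → List Y) xs →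
                    countᵇ p (concatMap f xs) ≡ sum (map (countᵇ p ∘ f) xs)
  count-concatMap p f []       = refl
  count-concatMap p f (x ∷ xs) =
    trans (count-++ p (f x) (concatMap f xs)) (cong (countᵇ p (f x) +_) (count-concatMap p f xs))

  allᵇ-map : ∀ (p : Y → Bool) (f : X → Y) xs → allᵇ p (map f xs) ≡ allᵇ (p ∘ f) xs
  allᵇ-map p f []       = refl
  allᵇ-map p f (x ∷ xs) = cong (p (f x) ∧_) (allᵇ-map p f xs)

allᵇ-applyUpTo : ∀ {X : Set} (p : X → Bool) f m → allᵇ p (applyUpTo f m) ≡ allᵇ (p ∘ f) (upTo m)
allᵇ-applyUpTo p f m = trans (cong (allᵇ p) (sym (map-applyUpTo id f m))) (allᵇ-map p f (upTo m))

map-at-upto1 : ∀ {X : Set} (d : X) xs → map (at d xs) (upto1 (length xs)) ≡ xs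
map-at-upto1 d []       = refl
map-at-upto1 d (x ∷ xs) = cong (x ∷_) (begin
  map (at d (x ∷ xs)) (applyUpTo (suc ∘ suc) (length xs)) ≡⟨ map-applyUpTo (suc ∘ suc) (at d (x ∷ xs)) (length xs) ⟩
  applyUpTo (at d xs ∘ suc) (length xs)                   ≡⟨ map-applyUpTo suc (at d xs) (length xs) ⟨
  map (at d xs) (upto1 (length xs))                       ≡⟨ map-at-upto1 d xs ⟩
  xs                                                      ∎)

count-indices : ∀ {X : Set} (q : X → Bool) (d : X) xs →
                countᵇ (q ∘ at d xs) (upto1 (length xs)) ≡ countᵇ q xs
count-indices q d xs = trans (sym (count-map q (at d xs) (upto1 (length xs)))) (cong (countᵇ q) (map-at-upto1 d xs))

-- The sets A_i as counts over S

_∈ᵇ_ : ℕ → List ℕ → Bool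
x ∈ᵇ ys = anyᵇ (x ≡ᵇ_) ys

∈ᵇ-filterᵇ : ∀ (p : ℕ → Bool) x ys → x ∈ᵇ filterᵇ p ys ≡ p x ∧ x ∈ᵇ ys
∈ᵇ-filterᵇ p x []       = sym (∧-zeroʳ (p x))
∈ᵇ-filterᵇ p x (y ∷ ys) with p y in py
... | true with x ≡ᵇ y in x≡ᵇy
...   | true  = sym (trans (∧-identityʳ (p x)) (trans (cong p (≡ᵇ⇒≡ x y (from T-≡ x≡ᵇy))) py))
...   | false = ∈ᵇ-filterᵇ p x ys
∈ᵇ-filterᵇ p x (y ∷ ys) | false with x ≡ᵇ y in x≡ᵇy
...   | true  = trans (∈ᵇ-filterᵇ p x ys) (trans (cong (_∧ x ∈ᵇ ys) px) (sym (cong (_∧ true) px)))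
  where px = trans (cong p (≡ᵇ⇒≡ x y (from T-≡ x≡ᵇy))) py
...   | false = ∈ᵇ-filterᵇ p x ys

∈ᵇ-self : ∀ xs → All (λ x → T (x ∈ᵇ xs)) xs
∈ᵇ-self []       = []
∈ᵇ-self (x ∷ xs) = from T-∨ (inj₁ (≡⇒≡ᵇ x x refl)) ∷ All.map (λ x∈xs → from T-∨ (inj₂ x∈xs)) (∈ᵇ-self xs)

length-filterᵇ-∩-filterᵇ : ∀ (p q : ℕ → Bool) xs →
                           length (filterᵇ p xs ∩ filterᵇ q xs) ≡ countᵇ (λ x → p x ∧ q x) xs
length-filterᵇ-∩-filterᵇ p q xs = begin
  countᵇ (_∈ᵇ filterᵇ q xs) (filterᵇ p xs)       ≡⟨ count-filter p (_∈ᵇ filterᵇ q xs) xs ⟩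
  countᵇ (λ x → p x ∧ x ∈ᵇ filterᵇ q xs) xs      ≡⟨ count-cong-local (All.map drop-membership (∈ᵇ-self xs)) ⟩
  countᵇ (λ x → p x ∧ q x) xs                    ∎
  where
  drop-membership : ∀ {x} → T (x ∈ᵇ xs) → p x ∧ x ∈ᵇ filterᵇ q xs ≡ p x ∧ q x
  drop-membership {x} x∈xs = cong (p x ∧_) (begin
    x ∈ᵇ filterᵇ q xs  ≡⟨ ∈ᵇ-filterᵇ q x xs ⟩
    q x ∧ x ∈ᵇ xs      ≡⟨ cong (q x ∧_) (to T-≡ x∈xs) ⟩
    q x ∧ true         ≡⟨ ∧-identityʳ (q x) ⟩
    q x                ∎)

notDesᵇ : ℕ → List ℕ → ℕ → Bool
notDesᵇ n π i = not (desᵇ n π i)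

length-A : ∀ n S i → length (A n S i) ≡ countᵇ (λ π → notDesᵇ n π i) S
length-A n S i = count-indices (λ π → notDesᵇ n π i) [] S

length-A-∩ : ∀ n S i j → length (A n S i ∩ A n S j) ≡ countᵇ (λ π → notDesᵇ n π i ∧ notDesᵇ n π j) S
length-A-∩ n S i j =
  trans (length-filterᵇ-∩-filterᵇ _ _ (upto1 (length S))) (count-indices (λ π → notDesᵇ n π i ∧ notDesᵇ n π j) [] S)

length-A-∩-comm : ∀ n S i j → length (A n S i ∩ A n S j) ≡ length (A n S j ∩ A n S i)
length-A-∩-comm n S i j = begin
  length (A n S i ∩ A n S j)                          ≡⟨ length-A-∩ n S i j ⟩
  countᵇ (λ π → notDesᵇ n π i ∧ notDesᵇ n π j) S    ≡⟨ count-cong (λ π → ∧-comm (notDesᵇ n π i) _) S ⟩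
  countᵇ (λ π → notDesᵇ n π j ∧ notDesᵇ n π i) S    ≡⟨ length-A-∩ n S j i ⟨
  length (A n S j ∩ A n S i)                          ∎

-- Words over [k] and their contents

InRange : ℕ → ℕ → Set
InRange k x = 1 ≤ x × x ≤ k

upto1-InRange : ∀ k → All (InRange k) (upto1 k)
upto1-InRange k = applyUpTo⁺₁ suc k (λ i<k → s≤s z≤n , i<k)

words-spec : ∀ k n → All (λ s → length s ≡ n × All (InRange k) s) (words k n)
words-spec k zero    = (refl , []) ∷ []
words-spec k (suc n) = concat⁺ (map⁺ (All.map prepend (upto1-InRange k)))
  where
  prepend : ∀ {c} → InRange k c → All (λ s → length s ≡ suc n × All (InRange k) s) (map (c ∷_) (words k n))
  prepend c∈ = map⁺ (All.map (λ (len , s∈) → cong suc len , c∈ ∷ s∈) (words-spec k n))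

upto1-suc : ∀ k → upto1 (suc k) ≡ 1 ∷ map suc (upto1 k)
upto1-suc k = cong (1 ∷_) (sym (map-applyUpTo suc suc k))

count-upto1-suc : ∀ (p : ℕ → Bool) k → countᵇ p (upto1 (suc k)) ≡ indicator (p 1) + countᵇ (p ∘ suc) (upto1 k)
count-upto1-suc p k = begin
  countᵇ p (upto1 (suc k))                            ≡⟨ cong (countᵇ p) (upto1-suc k) ⟩
  countᵇ p (1 ∷ map suc (upto1 k))                    ≡⟨ count-∷ p 1 (map suc (upto1 k)) ⟩
  indicator (p 1) + countᵇ p (map suc (upto1 k))      ≡⟨ cong (indicator (p 1) +_) (count-map p suc (upto1 k)) ⟩
  indicator (p 1) + countᵇ (p ∘ suc) (upto1 k)        ∎

count-≡ᵇ-upto1 : ∀ {k a} → InRange k a → countᵇ (_≡ᵇ a) (upto1 k) ≡ 1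
count-≡ᵇ-upto1 {suc k} {suc zero}    _             = trans (count-upto1-suc (_≡ᵇ 1) k) (cong suc (count-≡ᵇ0 k))
  where
  count-≡ᵇ0 : ∀ k → countᵇ (_≡ᵇ 0) (upto1 k) ≡ 0
  count-≡ᵇ0 zero    = refl
  count-≡ᵇ0 (suc k) = trans (count-upto1-suc (_≡ᵇ 0) k) (count-false (upto1 k))
count-≡ᵇ-upto1 {suc k} {suc (suc a)} (_ , s≤s a<k) = trans (count-upto1-suc (_≡ᵇ suc (suc a)) k) (count-≡ᵇ-upto1 (s≤s z≤n , a<k))

_≟ₗ_ : (s w : List ℕ) → _
_≟ₗ_ = ≡-dec _≟_

count-words-≟ : ∀ {k n w} → length w ≡ n → All (InRange k) w → countᵇ (λ s → does (s ≟ₗ w)) (words k n) ≡ 1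
count-words-≟ {k} {zero}  {[]}    _   _          = refl
count-words-≟ {k} {suc n} {a ∷ w} len (a∈ ∷ w∈) = begin
  countᵇ (λ s → does (s ≟ₗ (a ∷ w))) (concatMap (λ c → map (c ∷_) (words k n)) (upto1 k))
    ≡⟨ count-concatMap _ (λ c → map (c ∷_) (words k n)) (upto1 k) ⟩
  sum (map (λ c → countᵇ (λ s → does (s ≟ₗ (a ∷ w))) (map (c ∷_) (words k n))) (upto1 k))
    ≡⟨ cong sum (map-cong first-letter (upto1 k)) ⟩
  sum (map (indicator ∘ (_≡ᵇ a)) (upto1 k))
    ≡⟨ count-as-sum (_≡ᵇ a) (upto1 k) ⟨
  countᵇ (_≡ᵇ a) (upto1 k)
    ≡⟨ count-≡ᵇ-upto1 a∈ ⟩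
  1 ∎
  where
  first-letter : ∀ c → countᵇ (λ s → does (s ≟ₗ (a ∷ w))) (map (c ∷_) (words k n)) ≡ indicator (c ≡ᵇ a)
  first-letter c = begin
    countᵇ (λ s → does (s ≟ₗ (a ∷ w))) (map (c ∷_) (words k n))
      ≡⟨ count-map _ (c ∷_) (words k n) ⟩
    countᵇ (λ s → (c ≡ᵇ a) ∧ does (s ≟ₗ w)) (words k n)
      ≡⟨ count-const-∧ (c ≡ᵇ a) _ (words k n) ⟩
    indicator (c ≡ᵇ a) * countᵇ (λ s → does (s ≟ₗ w)) (words k n)
      ≡⟨ cong (indicator (c ≡ᵇ a) *_) (count-words-≟ (suc-injective len) w∈) ⟩
    indicator (c ≡ᵇ a) * 1
      ≡⟨ *-identityʳ _ ⟩
    indicator (c ≡ᵇ a) ∎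

ones : ℕ → List ℕ
ones m = replicate m 1

sortedWord : List ℕ → List ℕ
sortedWord []      = []
sortedWord (a ∷ α) = ones a ++ map suc (sortedWord α)

mult : ℕ → List ℕ → ℕ
mult c = countᵇ (_≡ᵇ c)

content : ℕ → List ℕ → List ℕ
content k s = map (λ c → mult c s) (upto1 k)

mult-replicate : ∀ c a b → mult c (replicate a b) ≡ indicator (b ≡ᵇ c) * a
mult-replicate c zero    b = sym (*-zeroʳ (indicator (b ≡ᵇ c)))
mult-replicate c (suc a) b = begin
  mult c (b ∷ replicate a b)                           ≡⟨ count-∷ (_≡ᵇ c) b (replicate a b) ⟩
  indicator (b ≡ᵇ c) + mult c (replicate a b)          ≡⟨ cong (indicator (b ≡ᵇ c) +_) (mult-replicate c a b) ⟩
  indicator (b ≡ᵇ c) + indicator (b ≡ᵇ c) * a          ≡⟨ *-suc (indicator (b ≡ᵇ c)) a ⟨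
  indicator (b ≡ᵇ c) * suc a                           ∎

mult-shift : ∀ a c t → mult (suc c) (ones a ++ map suc t) ≡ indicator (0 ≡ᵇ c) * a + mult c t
mult-shift a c t =
  trans (count-++ (_≡ᵇ suc c) (ones a) (map suc t)) (cong₂ _+_ (mult-replicate (suc c) a 1) (count-map (_≡ᵇ suc c) suc t))

mult-zero : ∀ {k s} → All (InRange k) s → mult 0 s ≡ 0
mult-zero []                   = refl
mult-zero ((s≤s z≤n , _) ∷ s∈) = mult-zero s∈

mult-one-shift : ∀ {k} a {t} → All (InRange k) t → mult 1 (ones a ++ map suc t) ≡ a
mult-one-shift a {t} t∈ = begin
  mult 1 (ones a ++ map suc t) ≡⟨ mult-shift a 0 t ⟩
  1 * a + mult 0 t             ≡⟨ cong₂ _+_ (*-identityˡ a) (mult-zero t∈) ⟩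
  a + 0                        ≡⟨ +-identityʳ a ⟩
  a                            ∎

sortedWord-InRange : ∀ α → All (InRange (length α)) (sortedWord α)
sortedWord-InRange []      = []
sortedWord-InRange (a ∷ α) =
  ++⁺ (replicate⁺ a (s≤s z≤n , s≤s z≤n)) (map⁺ (All.map (λ (_ , x≤k) → s≤s z≤n , s≤s x≤k) (sortedWord-InRange α)))

length-sortedWord : ∀ α → length (sortedWord α) ≡ sum α
length-sortedWord []      = refl
length-sortedWord (a ∷ α) = begin
  length (ones a ++ map suc (sortedWord α))          ≡⟨ length-++ (ones a) ⟩
  length (ones a) + length (map suc (sortedWord α))  ≡⟨ cong₂ _+_ (length-replicate a) (length-map suc (sortedWord α)) ⟩
  a + length (sortedWord α)                          ≡⟨ cong (a +_) (length-sortedWord α) ⟩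
  a + sum α                                          ∎

mult-sortedWord : ∀ α c → mult (suc c) (sortedWord α) ≡ at 0 α (suc c)
mult-sortedWord []      c       = refl
mult-sortedWord (a ∷ α) zero    = mult-one-shift a (sortedWord-InRange α)
mult-sortedWord (a ∷ α) (suc c) = trans (mult-shift a (suc c) (sortedWord α)) (mult-sortedWord α c)

content-sortedWord : ∀ α → T (hasContentᵇ α (sortedWord α))
content-sortedWord α = allᵇ⁺ (applyUpTo⁺₂ suc (length α) (λ c → ≡⇒≡ᵇ _ _ (mult-sortedWord α c)))

unshift : ∀ {k s} → All (2 ≤_) s → All (InRange (suc k)) s → ∃[ t ] s ≡ map suc t × All (InRange k) t
unshift []                           []                       = [] , refl , []
unshift (s≤s (s≤s z≤n) ∷ s≥2) ((_ , s≤s x≤k) ∷ s∈) with unshift s≥2 s∈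
... | t , refl , t∈ = _ ∷ t , refl , (s≤s z≤n , x≤k) ∷ t∈

sorted-split : ∀ {k s} → Linked _≤_ s → All (InRange (suc k)) s →
               ∃[ a ] ∃[ t ] s ≡ ones a ++ map suc t × Linked _≤_ t × All (InRange k) t
sorted-split {s = []}               _  _        = 0 , [] , refl , [] , []
sorted-split {s = suc zero ∷ s}     s↗ (_ ∷ s∈) with sorted-split (Linked.tail s↗) s∈
... | a , t , refl , t↗ , t∈ = suc a , t , refl , t↗ , t∈
sorted-split {s = suc (suc x) ∷ s} s↗ s∈ with unshift (Linked⇒All ≤-trans (s≤s (s≤s z≤n)) s↗) s∈
... | t , s≡ , t∈ = 0 , t , s≡ , Linked.map s≤s⁻¹ (Linkedₚ.map⁻ (subst (Linked _≤_) s≡ s↗)) , t∈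

sorted-≡-sortedWord-content : ∀ k {s} → Linked _≤_ s → All (InRange k) s → s ≡ sortedWord (content k s)
sorted-≡-sortedWord-content zero    {[]}    _  _                 = refl
sorted-≡-sortedWord-content zero    {_ ∷ _} _  ((s≤s _ , ()) ∷ _)
sorted-≡-sortedWord-content (suc k) s↗ s∈ with sorted-split s↗ s∈
... | a , t , refl , t↗ , t∈ = cong₂ (λ m u → ones m ++ map suc u)
  (sym (mult-one-shift a t∈)) (trans (sorted-≡-sortedWord-content k t↗ t∈) (cong sortedWord content-shift))
  where
  s = ones a ++ map suc t
  content-shift : content k t ≡ map (λ c → mult c s) (applyUpTo (suc ∘ suc) k)
  content-shift = begin
    map (λ c → mult c t) (upto1 k)                 ≡⟨ map-cong-local (All.map (λ { (s≤s z≤n , _) → sym (mult-shift a _ t) }) (upto1-InRange k)) ⟩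
    map (λ c → mult (suc c) s) (upto1 k)           ≡⟨ map-∘ (upto1 k) ⟩
    map (λ c → mult c s) (map suc (upto1 k))       ≡⟨ cong (map (λ c → mult c s)) (map-applyUpTo suc suc k) ⟩
    map (λ c → mult c s) (applyUpTo (suc ∘ suc) k) ∎

sortedWord-unique : ∀ {α s} → Linked _≤_ s → All (InRange (length α)) s → T (hasContentᵇ α s) → s ≡ sortedWord α
sortedWord-unique {α} {s} s↗ s∈ has-α = trans (sorted-≡-sortedWord-content (length α) s↗ s∈) (cong sortedWord content≡α)
  where
  content≡α : content (length α) s ≡ α
  content≡α = trans (map-cong-local (All.map (≡ᵇ⇒≡ _ _) (allᵇ⁻ (upto1 (length α)) has-α))) (map-at-upto1 0 α)

ascendsᵇ : Bool → ℕ → ℕ → Bool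
ascendsᵇ strict x y = if strict then x <ᵇ y else x ≤ᵇ y

-- admissibleᵇ read along the word: D is shifted so that D 1 always constrains the first pair.
admissible : (ℕ → Bool) → List ℕ → Bool
admissible D []          = true
admissible D (_ ∷ [])    = true
admissible D (x ∷ y ∷ s) = ascendsᵇ (D 1) x y ∧ admissible (D ∘ suc) (y ∷ s)

admissibleᵇ-admissible : ∀ {n} D s → length s ≡ n → admissibleᵇ n D s ≡ admissible D s
admissibleᵇ-admissible D []          refl = refl
admissibleᵇ-admissible D (_ ∷ [])    refl = refl
admissibleᵇ-admissible D (x ∷ y ∷ s) refl = cong (ascendsᵇ (D 1) x y ∧_) (begin
  allᵇ (ascentAt D (x ∷ y ∷ s)) (applyUpTo (suc ∘ suc) (length s))
    ≡⟨ allᵇ-applyUpTo (ascentAt D (x ∷ y ∷ s)) (suc ∘ suc) (length s) ⟩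
  allᵇ (ascentAt (D ∘ suc) (y ∷ s) ∘ suc) (upTo (length s))
    ≡⟨ allᵇ-applyUpTo (ascentAt (D ∘ suc) (y ∷ s)) suc (length s) ⟨
  admissibleᵇ (length (y ∷ s)) (D ∘ suc) (y ∷ s)
    ≡⟨ admissibleᵇ-admissible (D ∘ suc) (y ∷ s) refl ⟩
  admissible (D ∘ suc) (y ∷ s) ∎)
  where
  ascentAt : (ℕ → Bool) → List ℕ → ℕ → Bool
  ascentAt D w j = ascendsᵇ (D j) (at 0 w j) (at 0 w (suc j))

ascendsᵇ⇒≤ : ∀ strict x y → T (ascendsᵇ strict x y) → x ≤ y
ascendsᵇ⇒≤ true  x y = <⇒≤ ∘ <ᵇ⇒< x y
ascendsᵇ⇒≤ false x y = ≤ᵇ⇒≤ x y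

admissible⇒sorted : ∀ D s → T (admissible D s) → Linked _≤_ s
admissible⇒sorted D []          _  = []
admissible⇒sorted D (_ ∷ [])    _  = [-]
admissible⇒sorted D (x ∷ y ∷ s) ok =
  ascendsᵇ⇒≤ (D 1) x y (proj₁ (to T-∧ ok)) ∷ admissible⇒sorted (D ∘ suc) (y ∷ s) (proj₂ (to T-∧ ok))

ascendsᵇ-suc : ∀ strict x y → ascendsᵇ strict (suc x) (suc y) ≡ ascendsᵇ strict x y
ascendsᵇ-suc true  x       y = refl
ascendsᵇ-suc false zero    y = refl
ascendsᵇ-suc false (suc x) y = refl

admissible-map-suc : ∀ D s → admissible D (map suc s) ≡ admissible D s
admissible-map-suc D []          = refl
admissible-map-suc D (_ ∷ [])    = refl
admissible-map-suc D (x ∷ y ∷ s) = cong₂ _∧_ (ascendsᵇ-suc (D 1) x y) (admissible-map-suc (D ∘ suc) (y ∷ s))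

admissible-run : ∀ D a α →
  admissible D (sortedWord (2 + a ∷ α)) ≡ not (D 1) ∧ admissible (D ∘ suc) (sortedWord (suc a ∷ α))
admissible-run D a α = cong (_∧ admissible (D ∘ suc) (sortedWord (suc a ∷ α))) (equal-letters (D 1))
  where
  equal-letters : ∀ strict → ascendsᵇ strict 1 1 ≡ not strict
  equal-letters true  = refl
  equal-letters false = refl

admissible-boundary : ∀ D a α →
  admissible D (sortedWord (1 ∷ suc a ∷ α)) ≡ admissible (D ∘ suc) (sortedWord (suc a ∷ α))
admissible-boundary D a α =
  trans (cong (_∧ admissible (D ∘ suc) (map suc (sortedWord (suc a ∷ α)))) (distinct-letters (D 1)))
        (admissible-map-suc (D ∘ suc) (sortedWord (suc a ∷ α)))
  where
  distinct-letters : ∀ strict → ascendsᵇ strict 1 2 ≡ true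
  distinct-letters true  = refl
  distinct-letters false = refl

admissible-ones : ∀ D m → admissible D (sortedWord (ones m)) ≡ true
admissible-ones D zero          = refl
admissible-ones D (suc zero)    = refl
admissible-ones D (suc (suc m)) = trans (admissible-boundary D 0 (ones m)) (admissible-ones (D ∘ suc) (suc m))

admissible-ones-++ : ∀ D p a α →
  admissible D (sortedWord (ones p ++ suc a ∷ α)) ≡ admissible (D ∘ (p +_)) (sortedWord (suc a ∷ α))
admissible-ones-++ D zero          a α = refl
admissible-ones-++ D (suc zero)    a α = admissible-boundary D a α
admissible-ones-++ D (suc (suc p)) a α =
  trans (admissible-boundary D 0 (ones p ++ suc a ∷ α)) (admissible-ones-++ (D ∘ suc) (suc p) a α)

admissible-single : ∀ D p q → admissible D (sortedWord (ones p ++ 2 ∷ ones q)) ≡ not (D (suc p))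
admissible-single D p q = begin
  admissible D (sortedWord (ones p ++ 2 ∷ ones q))            ≡⟨ admissible-ones-++ D p 1 (ones q) ⟩
  admissible (D ∘ (p +_)) (sortedWord (2 ∷ ones q))           ≡⟨ admissible-run (D ∘ (p +_)) 0 (ones q) ⟩
  not (D (p + 1)) ∧ admissible _ (sortedWord (ones (suc q)))  ≡⟨ cong₂ _∧_ (cong (not ∘ D) (+-comm p 1)) (admissible-ones _ (suc q)) ⟩
  not (D (suc p)) ∧ true                                      ≡⟨ ∧-identityʳ _ ⟩
  not (D (suc p))                                             ∎

admissible-adjacent : ∀ D p q →
  admissible D (sortedWord (ones p ++ 3 ∷ ones q)) ≡ not (D (suc p)) ∧ not (D (2 + p))
admissible-adjacent D p q = begin
  admissible D (sortedWord (ones p ++ 3 ∷ ones q))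
    ≡⟨ admissible-ones-++ D p 2 (ones q) ⟩
  admissible (D ∘ (p +_)) (sortedWord (3 ∷ ones q))
    ≡⟨ admissible-run (D ∘ (p +_)) 1 (ones q) ⟩
  not (D (p + 1)) ∧ admissible (D ∘ (p +_) ∘ suc) (sortedWord (2 ∷ ones q))
    ≡⟨ cong (not (D (p + 1)) ∧_) (admissible-single (D ∘ (p +_) ∘ suc) 0 q) ⟩
  not (D (p + 1)) ∧ not (D (p + 2))
    ≡⟨ cong₂ (λ i j → not (D i) ∧ not (D j)) (+-comm p 1) (+-comm p 2) ⟩
  not (D (suc p)) ∧ not (D (2 + p)) ∎

admissible-distant : ∀ D p d r →
  admissible D (sortedWord (ones p ++ 2 ∷ ones d ++ 2 ∷ ones r)) ≡ not (D (suc p)) ∧ not (D (3 + (p + d)))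
admissible-distant D p d r = begin
  admissible D (sortedWord (ones p ++ 2 ∷ ones d ++ 2 ∷ ones r))
    ≡⟨ admissible-ones-++ D p 1 (ones d ++ 2 ∷ ones r) ⟩
  admissible (D ∘ (p +_)) (sortedWord (2 ∷ ones d ++ 2 ∷ ones r))
    ≡⟨ admissible-run (D ∘ (p +_)) 0 (ones d ++ 2 ∷ ones r) ⟩
  not (D (p + 1)) ∧ admissible (D ∘ (p +_) ∘ suc) (sortedWord (ones (suc d) ++ 2 ∷ ones r))
    ≡⟨ cong (not (D (p + 1)) ∧_) (admissible-single (D ∘ (p +_) ∘ suc) (suc d) r) ⟩
  not (D (p + 1)) ∧ not (D (p + (3 + d)))
    ≡⟨ cong₂ (λ i j → not (D i) ∧ not (D j)) (+-comm p 1) (trans (sym (+-assoc p 3 d)) (cong (_+ d) (+-comm p 3))) ⟩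
  not (D (suc p)) ∧ not (D (3 + (p + d))) ∎

-- Coefficients of F_D and of Σ_π F_(Des π)

holds-only-at : ∀ {X : Set} (_≟_ : DecidableEquality X) (P : X → Bool) w {s} →
                (T (P s) → s ≡ w) → P s ≡ P w ∧ does (s ≟ w)
holds-only-at _≟_ P w {s} P⇒≡w with s ≟ w
... | yes refl = sym (∧-identityʳ (P s))
... | no  s≢w with P s
...   | true  = ⊥-elim (s≢w (P⇒≡w tt))
...   | false = sym (∧-zeroʳ (P w))

coeffF-sortedWord : ∀ {n} D α → sum α ≡ n → coeffF n D α ≡ indicator (admissible D (sortedWord α))
coeffF-sortedWord {n} D α sum≡n = begin
  countᵇ P (words k n)
    ≡⟨ count-cong-local (All.map only-at-w (words-spec k n)) ⟩
  countᵇ (λ s → P w ∧ does (s ≟ₗ w)) (words k n)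
    ≡⟨ count-const-∧ (P w) _ (words k n) ⟩
  indicator (P w) * countᵇ (λ s → does (s ≟ₗ w)) (words k n)
    ≡⟨ cong₂ (λ b c → indicator b * c) Pw≡ (count-words-≟ length-w (sortedWord-InRange α)) ⟩
  indicator (admissible D w) * 1
    ≡⟨ *-identityʳ _ ⟩
  indicator (admissible D w) ∎
  where
  k = length α
  w = sortedWord α
  P : List ℕ → Bool
  P s = admissibleᵇ n D s ∧ hasContentᵇ α s
  length-w : length w ≡ n
  length-w = trans (length-sortedWord α) sum≡n
  only-at-w : ∀ {s} → length s ≡ n × All (InRange k) s → P s ≡ P w ∧ does (s ≟ₗ w)
  only-at-w {s} (len , s∈) = holds-only-at _≟ₗ_ P w λ Ps →
    let adm , has-α = to T-∧ Ps
    in sortedWord-unique {α} (admissible⇒sorted D s (subst T (admissibleᵇ-admissible D s len) adm)) s∈ has-α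
  Pw≡ : P w ≡ admissible D w
  Pw≡ = trans (cong₂ _∧_ (admissibleᵇ-admissible D w length-w) (to T-≡ (content-sortedWord α))) (∧-identityʳ _)

coeffSum-≡-count : ∀ {n} S α → sum α ≡ n →
                   coeffSum n S α ≡ countᵇ (λ π → admissible (desᵇ n π) (sortedWord α)) S
coeffSum-≡-count {n} S α sum≡n =
  trans (cong sum (map-cong (λ π → coeffF-sortedWord (desᵇ n π) α sum≡n) S)) (sym (count-as-sum _ S))

-- Applying symmetry

ones-++ : ∀ p q → ones p ++ ones q ≡ ones (p + q)
ones-++ zero    q = refl
ones-++ (suc p) q = cong (1 ∷_) (ones-++ p q)

sum-ones : ∀ m → sum (ones m) ≡ m
sum-ones zero    = refl
sum-ones (suc m) = cong suc (sum-ones m)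

ones-insert : ∀ v p q → ones p ++ v ∷ ones q ↭ v ∷ ones (p + q)
ones-insert v p q = ↭-trans (shift v (ones p) (ones q)) (↭-reflexive (cong (v ∷_) (ones-++ p q)))

ones-insert₂ : ∀ v w p q r → ones p ++ v ∷ ones q ++ w ∷ ones r ↭ v ∷ w ∷ ones (p + q + r)
ones-insert₂ v w p q r = ↭-trans (shift v (ones p) (ones q ++ w ∷ ones r)) (prep v (↭-trans
  (↭-reflexive (trans (sym (++-assoc (ones p) (ones q) (w ∷ ones r))) (cong (_++ w ∷ ones r) (ones-++ p q))))
  (ones-insert w (p + q) r)))

count-notDes : ∀ {n S i} → Symmetric n S → 1 ≤ i → i ≤ n ∸ 1 →
               countᵇ (λ π → notDesᵇ n π i) S ≡ coeffSum n S (2 ∷ ones (n ∸ 2))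
count-notDes {i = zero}              _ () _
count-notDes {zero}  {i = suc _}     _ _  ()
count-notDes {suc n} {S} {suc p} S-sym _ i≤n with m≤n⇒∃[o]m+o≡n i≤n
... | q , refl = begin
  countᵇ (λ π → notDesᵇ N π (suc p)) S
    ≡⟨ count-cong (λ π → admissible-single (desᵇ N π) p q) S ⟨
  countᵇ (λ π → admissible (desᵇ N π) (sortedWord α)) S
    ≡⟨ coeffSum-≡-count S α (trans (sum-↭ (ones-insert 2 p q)) (cong (2 +_) (sum-ones (p + q)))) ⟨
  coeffSum N S α
    ≡⟨ S-sym α _ (ones-insert 2 p q) ⟩
  coeffSum N S (2 ∷ ones (p + q)) ∎
  where
  N = 2 + (p + q)
  α = ones p ++ 2 ∷ ones q

count-notDes-adjacent : ∀ {n S i} → Symmetric n S → 1 ≤ i → suc i ≤ n ∸ 1 →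
  countᵇ (λ π → notDesᵇ n π i ∧ notDesᵇ n π (suc i)) S ≡ coeffSum n S (3 ∷ ones (n ∸ 3))
count-notDes-adjacent {i = zero}          _ () _
count-notDes-adjacent {zero}  {i = suc _} _ _  ()
count-notDes-adjacent {suc n} {S} {suc p} S-sym _ i+1≤n with m≤n⇒∃[o]m+o≡n i+1≤n
... | q , refl = begin
  countᵇ (λ π → notDesᵇ N π (suc p) ∧ notDesᵇ N π (2 + p)) S
    ≡⟨ count-cong (λ π → admissible-adjacent (desᵇ N π) p q) S ⟨
  countᵇ (λ π → admissible (desᵇ N π) (sortedWord α)) S
    ≡⟨ coeffSum-≡-count S α (trans (sum-↭ (ones-insert 3 p q)) (cong (3 +_) (sum-ones (p + q)))) ⟨
  coeffSum N S α
    ≡⟨ S-sym α _ (ones-insert 3 p q) ⟩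
  coeffSum N S (3 ∷ ones (p + q)) ∎
  where
  N = 3 + (p + q)
  α = ones p ++ 3 ∷ ones q

count-notDes-distant : ∀ {n S i} d → Symmetric n S → 1 ≤ i → 2 + i + d ≤ n ∸ 1 →
  countᵇ (λ π → notDesᵇ n π i ∧ notDesᵇ n π (2 + i + d)) S ≡ coeffSum n S (2 ∷ 2 ∷ ones (n ∸ 4))
count-notDes-distant {i = zero}          _ _ () _
count-notDes-distant {zero}  {i = suc _} _ _ _  ()
count-notDes-distant {suc n} {S} {suc p} d S-sym _ j≤n with m≤n⇒∃[o]m+o≡n j≤n
... | r , refl = begin
  countᵇ (λ π → notDesᵇ N π (suc p) ∧ notDesᵇ N π (3 + (p + d))) S
    ≡⟨ count-cong (λ π → admissible-distant (desᵇ N π) p d r) S ⟨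
  countᵇ (λ π → admissible (desᵇ N π) (sortedWord α)) S
    ≡⟨ coeffSum-≡-count S α (trans (sum-↭ (ones-insert₂ 2 2 p d r)) (cong (4 +_) (sum-ones (p + d + r)))) ⟨
  coeffSum N S α
    ≡⟨ S-sym α _ (ones-insert₂ 2 2 p d r) ⟩
  coeffSum N S (2 ∷ 2 ∷ ones (p + d + r)) ∎
  where
  N = 4 + (p + d + r)
  α = ones p ++ 2 ∷ ones d ++ 2 ∷ ones r

∣-∣≡1⇒adjacent : ∀ i j → ∣ i - j ∣ ≡ 1 → j ≡ suc i ⊎ i ≡ suc j
∣-∣≡1⇒adjacent zero    j       eq = inj₁ eq
∣-∣≡1⇒adjacent (suc i) zero    eq = inj₂ eq
∣-∣≡1⇒adjacent (suc i) (suc j) eq = Sum.map (cong suc) (cong suc) (∣-∣≡1⇒adjacent i j eq)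

2≤∣-∣⇒distant : ∀ i j → 2 ≤ ∣ i - j ∣ → (∃[ d ] j ≡ 2 + i + d) ⊎ (∃[ d ] i ≡ 2 + j + d)
2≤∣-∣⇒distant zero          zero          ()
2≤∣-∣⇒distant zero          (suc zero)    (s≤s ())
2≤∣-∣⇒distant zero          (suc (suc d)) _  = inj₁ (d , refl)
2≤∣-∣⇒distant (suc zero)    zero          (s≤s ())
2≤∣-∣⇒distant (suc (suc d)) zero          _  = inj₂ (d , refl)
2≤∣-∣⇒distant (suc i)       (suc j)       le = Sum.map (map₂ (cong suc)) (map₂ (cong suc)) (2≤∣-∣⇒distant i j le)

length-A-∩-adjacent : ∀ {n S} → Symmetric n S → ∀ i j → 1 ≤ i → i ≤ n ∸ 1 → 1 ≤ j → j ≤ n ∸ 1 →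
  ∣ i - j ∣ ≡ 1 → length (A n S i ∩ A n S j) ≡ coeffSum n S (3 ∷ ones (n ∸ 3))
length-A-∩-adjacent {n} {S} S-sym i j 1≤i i≤n 1≤j j≤n ∣i-j∣≡1 with ∣-∣≡1⇒adjacent i j ∣i-j∣≡1
... | inj₁ refl = trans (length-A-∩ n S i j) (count-notDes-adjacent {n} {S} S-sym 1≤i j≤n)
... | inj₂ refl = trans (length-A-∩-comm n S i j) (trans (length-A-∩ n S j i) (count-notDes-adjacent {n} {S} S-sym 1≤j i≤n))

length-A-∩-distant : ∀ {n S} → Symmetric n S → ∀ i j → 1 ≤ i → i ≤ n ∸ 1 → 1 ≤ j → j ≤ n ∸ 1 →
  2 ≤ ∣ i - j ∣ → length (A n S i ∩ A n S j) ≡ coeffSum n S (2 ∷ 2 ∷ ones (n ∸ 4))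
length-A-∩-distant {n} {S} S-sym i j 1≤i i≤n 1≤j j≤n 2≤∣i-j∣ with 2≤∣-∣⇒distant i j 2≤∣i-j∣
... | inj₁ (d , refl) = trans (length-A-∩ n S i j) (count-notDes-distant {n} {S} d S-sym 1≤i j≤n)
... | inj₂ (d , refl) = trans (length-A-∩-comm n S i j) (trans (length-A-∩ n S j i) (count-notDes-distant {n} {S} d S-sym 1≤j i≤n))

lemma4p3 : (n : ℕ) (S : List (List ℕ)) → All (IsPerm n) S → Unique S → Symmetric n S →
    ∃[ k ] ∃[ ℓ₁ ] ∃[ ℓ₂ ]
      ((∀ i → 1 ≤ i → i ≤ n ∸ 1 → length (A n S i) ≡ k)
      × (∀ i j → 1 ≤ i → i ≤ n ∸ 1 → 1 ≤ j → j ≤ n ∸ 1 → ∣ i - j ∣ ≡ 1 → length (A n S i ∩ A n S j) ≡ ℓ₁)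
      × (∀ i j → 1 ≤ i → i ≤ n ∸ 1 → 1 ≤ j → j ≤ n ∸ 1 → 2 ≤ ∣ i - j ∣ → length (A n S i ∩ A n S j) ≡ ℓ₂))
lemma4p3 n S _ _ S-sym =
  coeffSum n S (2 ∷ ones (n ∸ 2)) , coeffSum n S (3 ∷ ones (n ∸ 3)) , coeffSum n S (2 ∷ 2 ∷ ones (n ∸ 4)) ,
  (λ i 1≤i i≤n → trans (length-A n S i) (count-notDes {n} {S} S-sym 1≤i i≤n)) ,
  length-A-∩-adjacent {n} {S} S-sym ,
  length-A-∩-distant {n} {S} S-sym
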